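{- Let $k$ be a positive integer. Let $G=(V,E)$ be a connected graph of order $n$, and let $X\subseteq V$ be such that $G[X]$ is connected. Let $G_1,\dots,G_r$ be the nontrivial connected components of $G-X$ (those with more than one vertex), indexed so that $|V(G_i)|\le |V(G_{i+1})|$ for $1\le i\le r-1$. If $k+n-1\ge \mathrm{prf}(G)$, then $k+2\ge r$ and $2k\ge \sum_{i=1}^{r-2}|V(G_i)|$.
   Context: An ordering of a graph $G=(V,E)$ is a bijection $\alpha:V\to\{1,\dots,|V|\}$; with $N[v]=\{v\}\cup\{u:uv\in E\}$ its profile is $\mathrm{prf}_\alpha(G)=\sum_{v\in V}(\alpha(v)-\min\{\alpha(u):u\in N[v]\})$, and $\mathrm{prf}(G)$ is the minimum of $\mathrm{prf}_\alpha(G)$ over all orderings $\alpha$ of $G$. -}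

module Defs where

open import Data.Bool using (Bool; true; false; if_then_else_; _∨_)
open import Data.Nat using (ℕ; zero; suc; _+_; _∸_; _≤_; _⊓_)
open import Data.Fin using (Fin; toℕ; _≟_)
open import Data.Fin.Subset using (Subset; _∈_; _∉_; ∣_∣; ⊤)
open import Data.Fin.Permutation using (Permutation′; _⟨$⟩ʳ_)
open import Data.List using (List; foldr; map; allFin; length; take)
open import Data.Nat.ListAction using (sum)
open import Data.List.Relation.Unary.Unique.Propositional using (Unique)
open import Data.List.Relation.Unary.Linked using (Linked)
open import Data.List.Membership.Propositional using () renaming (_∈_ to _∈ₗ_)
open import Data.Product using (Σ; _×_; ∃)
open import Relation.Nullary.Decidable using (⌊_⌋)
open import Relation.Binary.PropositionalEquality using (_≡_)

record Graph (n : ℕ) : Set where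
  field
    adj   : Fin n → Fin n → Bool
    sym   : ∀ u v → adj u v ≡ adj v u
    irrefl : ∀ v → adj v v ≡ false
open Graph public

module _ {n : ℕ} (G : Graph n) where

  data ReachIn (S : Subset n) : Fin n → Fin n → Set where
    here : ∀ {u} → u ∈ S → ReachIn S u u
    step : ∀ {u w v} → u ∈ S → adj G u w ≡ true → ReachIn S w v → ReachIn S u v

  InducedConnected : Subset n → Set
  InducedConnected S = ∀ u v → u ∈ S → v ∈ S → ReachIn S u v

  Connected : Set
  Connected = ∀ (u v : Fin n) → ReachIn ⊤ u v

  IsComponentOfMinus : Subset n → Subset n → Set
  IsComponentOfMinus X C =
      (∃ λ v → v ∈ C)
    × (∀ v → v ∈ C → v ∉ X)
    × InducedConnected C
    × (∀ u v → u ∈ C → v ∉ X → adj G u v ≡ true → v ∈ C)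

  IsNontrivialComponentOfMinus : Subset n → Subset n → Set
  IsNontrivialComponentOfMinus X C = IsComponentOfMinus X C × 2 ≤ ∣ C ∣

  inN : Fin n → Fin n → Bool
  inN v u = ⌊ u ≟ v ⌋ ∨ adj G v u

  -- Positions are taken 0-based (α(v) = toℕ (α ⟨$⟩ʳ v) + 1 in the paper's
  -- convention); the profile only involves differences, so this is harmless.
  pos : Permutation′ n → Fin n → ℕ
  pos α v = toℕ (α ⟨$⟩ʳ v)

  minN : Permutation′ n → Fin n → ℕ
  minN α v = foldr (λ u acc → if inN v u then pos α u ⊓ acc else acc) (pos α v) (allFin n)

  profileOf : Permutation′ n → ℕ
  profileOf α = sum (map (λ v → pos α v ∸ minN α v) (allFin n))

  IsProfile : ℕ → Set
  IsProfile p = (∃ λ α → profileOf α ≡ p) × (∀ α → p ≤ profileOf α)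

  NontrivialComponentsList : Subset n → List (Subset n) → Set
  NontrivialComponentsList X cs =
      (∀ C → C ∈ₗ cs → IsNontrivialComponentOfMinus X C)
    × (∀ C → IsNontrivialComponentOfMinus X C → C ∈ₗ cs)
    × Unique cs
    × Linked (λ A B → ∣ A ∣ ≤ ∣ B ∣) cs

-- Write prf_α(G) as a sum over cuts: the cut i (1 ≤ i ≤ n − 1) is crossed by the
-- vertices at position ≥ i having a closed neighbour at position < i, and a vertex v
-- crosses exactly the cuts between min α(N[v]) and α(v).  Call a nontrivial component
-- of G − X inner if it contains neither the first nor the last vertex of α; all but at
-- most two components are inner.  Every cut is crossed by some vertex outside the inner
-- components: inside X if X lies on both sides of it, and otherwise on a walk from the
-- end vertex on the X-free side, which stays in that end vertex's component of G − X
-- until it crosses.  Moreover an inner component C, being connected, contains its own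
-- crossing vertex at each of the at least |C| − 1 cuts it spans.  Since components are
-- disjoint, prf_α(G) ≥ (n − 1) + Σ_{C inner} (|C| − 1), so Σ_{C inner} (|C| − 1) ≤ k.
-- As |C| ≥ 2, there are at most k inner components, of total size at most 2k, and as
-- the list is sorted, its r − 2 smallest members weigh no more than the inner ones.

{-# OPTIONS --safe #-}
module Submission where

open import Defs renaming (sym to adj-sym)
open import Data.Nat using (ℕ; zero; suc; _+_; _∸_; _*_; _≤_; _<_; NonZero)
open import Data.Nat using (_⊓_; _≤?_; _<?_; z≤n; s≤s; s≤s⁻¹; s<s⁻¹)
open import Data.Product using (_×_; _,_; proj₁; proj₂; ∃; ∃₂)
open import Data.Nat.ListAction using (sum)
open import Data.List using (List; []; _∷_; map; length; take; tabulate; lookup; filter; allFin; foldr)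
open import Data.Fin.Subset using (Subset; ∣_∣; inside; outside; _∈_; _∉_)

open import Data.Nat.Properties
open import Algebra.Properties.CommutativeMonoid.Sum +-0-commutativeMonoid
  using (sum-syntax; ∑-comm; ∑-distrib-+; ∑-permute; sum-cong-≗; sum-replicate-zero)
open import Data.Bool using (true; false; if_then_else_; _∨_)
open import Data.Bool.Properties using (∨-zeroʳ)
open import Data.Fin using (Fin; zero; suc; toℕ; fromℕ)
import Data.Fin.Properties as Fin
open import Data.Fin.Permutation using (Permutation′; _⟨$⟩ʳ_; _⟨$⟩ˡ_; inverseˡ; inverseʳ)
open import Data.Fin.Subset.Properties using (_∈?_; ⊆-antisym)
open import Data.List.Membership.Propositional using () renaming (_∈_ to _∈ₗ_)
open import Data.List.Membership.Propositional.Properties using (∈-lookup; ∈-allFin; ∈-filter⁻)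
open import Data.List.Properties using (filter-all; map-tabulate)
open import Data.List.Relation.Binary.Sublist.Propositional using (_⊆_; []; _∷ʳ_; _∷_; ⊆-trans)
open import Data.List.Relation.Binary.Sublist.Propositional.Properties using (length-mono-≤; filter-⊆)
open import Data.List.Relation.Unary.All as All using (All)
open import Data.List.Relation.Unary.AllPairs using (_∷_)
open import Data.List.Relation.Unary.Any using (here; there)
open import Data.List.Relation.Unary.Linked as Linked using (Linked; _∷_)
open import Data.List.Relation.Unary.Unique.Propositional using (Unique)
import Data.List.Relation.Unary.Unique.Propositional.Properties as Unique
import Data.Product as Product
open import Data.Unit using (⊤; tt)
import Data.Vec as Vec
open import Function using (_∘_; _on_; id)
open import Level using (Level)
open import Relation.Binary.PropositionalEquality
open import Relation.Nullary using (Dec; does; yes; no; ¬_; contradiction; _×-dec_; _→-dec_)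
open import Relation.Unary using (Pred; Decidable; ∁)
open import Relation.Unary.Properties using (∁?)

private
  variable
    a ℓ : Level
    A B : Set a
    n : ℕ

-- Defined through `does` so that it computes as soon as the boolean does,
-- e.g. 𝟙 (suc a <? suc b) = 𝟙 (a <? b) definitionally.
𝟙 : Dec A → ℕ
𝟙 a? = if does a? then 1 else 0

𝟙-mono : (A → B) → (a? : Dec A) (b? : Dec B) → 𝟙 a? ≤ 𝟙 b?
𝟙-mono _ (no _) _ = z≤n
𝟙-mono _ (yes _) (yes _) = ≤-refl
𝟙-mono A⇒B (yes a) (no ¬b) = contradiction (A⇒B a) ¬b

𝟙-yes : A → (a? : Dec A) → 𝟙 a? ≡ 1
𝟙-yes _ (yes _) = refl
𝟙-yes a (no ¬a) = contradiction a ¬a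

𝟙-no : ¬ A → (a? : Dec A) → 𝟙 a? ≡ 0
𝟙-no ¬a (yes a) = contradiction a ¬a
𝟙-no _ (no _) = refl

∑-mono-≤ : {f g : Fin n → ℕ} → (∀ i → f i ≤ g i) → ∑[ i < n ] f i ≤ ∑[ i < n ] g i
∑-mono-≤ {zero} _ = z≤n
∑-mono-≤ {suc n} f≤g = +-mono-≤ (f≤g zero) (∑-mono-≤ (f≤g ∘ suc))

∑-mono-< : {f g : Fin n → ℕ} → (∀ i → f i ≤ g i) → ∀ j → f j < g j
         → ∑[ i < n ] f i < ∑[ i < n ] g i
∑-mono-< f≤g zero fj<gj = +-mono-<-≤ fj<gj (∑-mono-≤ (f≤g ∘ suc))
∑-mono-< f≤g (suc j) fj<gj = +-mono-≤-< (f≤g zero) (∑-mono-< (f≤g ∘ suc) j fj<gj)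

term≤∑ : (f : Fin n → ℕ) → ∀ i → f i ≤ ∑[ j < n ] f j
term≤∑ f zero = m≤m+n _ _
term≤∑ f (suc i) = ≤-trans (term≤∑ (f ∘ suc) i) (m≤n+m _ _)

∑-const-1 : ∀ n → ∑[ i < n ] 1 ≡ n
∑-const-1 zero = refl
∑-const-1 (suc n) = cong suc (∑-const-1 n)

∑-𝟙-≡0 : {P : Pred (Fin n) ℓ} (P? : Decidable P) → (∀ i → ¬ P i) → ∑[ i < n ] 𝟙 (P? i) ≡ 0
∑-𝟙-≡0 {n} P? none = trans (sum-cong-≗ (λ i → 𝟙-no (none i) (P? i))) (sum-replicate-zero n)

∑-𝟙-≤1 : {P : Pred (Fin n) ℓ} (P? : Decidable P) → (∀ {i j} → P i → P j → i ≡ j)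
       → ∑[ i < n ] 𝟙 (P? i) ≤ 1
∑-𝟙-≤1 {zero} _ _ = z≤n
∑-𝟙-≤1 {suc n} P? unique with P? zero
... | yes p₀ = ≤-reflexive (cong suc (∑-𝟙-≡0 (P? ∘ suc) (λ i pᵢ → Fin.0≢1+n (unique p₀ pᵢ))))
... | no _ = ∑-𝟙-≤1 (P? ∘ suc) (λ pᵢ pⱼ → Fin.suc-injective (unique pᵢ pⱼ))

∑-below : ∀ N b → ∑[ j < N ] 𝟙 (toℕ j <? b) ≤ b
∑-below zero b = z≤n
∑-below (suc N) zero = ≤-reflexive (∑-𝟙-≡0 {suc N} (λ j → toℕ j <? 0) (λ _ ()))
∑-below (suc N) (suc b) = s≤s (∑-below N b)

∑-interval : ∀ N a b → ∑[ j < N ] 𝟙 (a <? toℕ j ×-dec toℕ j ≤? b) ≤ b ∸ a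
∑-interval zero a b = z≤n
∑-interval (suc N) zero b = ∑-below N b
∑-interval (suc N) (suc a) zero = ≤-reflexive (∑-𝟙-≡0 {suc N} (λ j → suc a <? toℕ j ×-dec toℕ j ≤? 0) empty)
  where
  empty : ∀ j → ¬ (suc a < toℕ j × toℕ j ≤ 0)
  empty _ (a<j , j≤0) = contradiction (≤-trans a<j j≤0) λ ()
∑-interval (suc N) (suc a) (suc b) = ≤-trans (∑-mono-≤ {N} shift) (∑-interval N a b)
  where
  shift : ∀ j → 𝟙 (suc a <? suc (toℕ j) ×-dec suc (toℕ j) ≤? suc b) ≤ 𝟙 (a <? toℕ j ×-dec toℕ j ≤? b)
  shift j = 𝟙-mono (Product.map s<s⁻¹ s≤s⁻¹) (suc a <? suc (toℕ j) ×-dec suc (toℕ j) ≤? suc b)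
                                              (a <? toℕ j ×-dec toℕ j ≤? b)

sum-tabulate : (f : Fin n → ℕ) → sum (tabulate f) ≡ ∑[ i < n ] f i
sum-tabulate {zero} f = refl
sum-tabulate {suc n} f = cong (f zero +_) (sum-tabulate (f ∘ suc))

sum-map-allFin : (f : Fin n → ℕ) → sum (map f (allFin n)) ≡ ∑[ i < n ] f i
sum-map-allFin f = trans (cong sum (map-tabulate id f)) (sum-tabulate f)

sum-map-lookup : (f : A → ℕ) (xs : List A) → sum (map f xs) ≡ ∑[ i < length xs ] f (lookup xs i)
sum-map-lookup f [] = refl
sum-map-lookup f (x ∷ xs) = cong (f x +_) (sum-map-lookup f xs)

∣p∣≡∑𝟙∈ : (p : Subset n) → ∣ p ∣ ≡ ∑[ v < n ] 𝟙 (v ∈? p)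
∣p∣≡∑𝟙∈ Vec.[] = refl
∣p∣≡∑𝟙∈ (outside Vec.∷ p) = ∣p∣≡∑𝟙∈ p
∣p∣≡∑𝟙∈ (inside Vec.∷ p) = cong suc (∣p∣≡∑𝟙∈ p)

module _ {A : Set a} where

  lookup-injective : {xs : List A} → Unique xs → ∀ {i j} → lookup xs i ≡ lookup xs j → i ≡ j
  lookup-injective (_ ∷ _) {zero} {zero} _ = refl
  lookup-injective (x∉xs ∷ _) {zero} {suc j} eq = contradiction eq (All.lookup x∉xs (∈-lookup j))
  lookup-injective (x∉xs ∷ _) {suc i} {zero} eq =
    contradiction (sym eq) (All.lookup x∉xs (∈-lookup i))
  lookup-injective (_ ∷ xs!) {suc i} {suc j} eq = cong suc (lookup-injective xs! eq)

  module _ {P : Pred A ℓ} (P? : Decidable P) where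

    length≤1+length-filter-∁ : {xs : List A} → Unique xs
                             → (∀ {x y} → x ∈ₗ xs → y ∈ₗ xs → P x → P y → x ≡ y)
                             → length xs ≤ suc (length (filter (∁? P?) xs))
    length≤1+length-filter-∁ {[]} _ _ = z≤n
    length≤1+length-filter-∁ {x ∷ xs} (x∉xs ∷ xs!) P-unique with P? x
    ... | yes px = ≤-reflexive (cong (suc ∘ length) (sym (filter-all (∁? P?) ∁P-xs)))
      where
      ∁P-xs : All (∁ P) xs
      ∁P-xs = All.tabulate λ y∈xs py →
        All.lookup x∉xs y∈xs (P-unique (here refl) (there y∈xs) px py)
    ... | no _ = s≤s (length≤1+length-filter-∁ xs! (λ x∈ y∈ → P-unique (there x∈) (there y∈)))

  module _ (f : A → ℕ) where

    sum-take-∷≤sum-take : ∀ {x xs} t → Linked (_≤_ on f) (x ∷ xs) → t ≤ length xs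
                        → sum (map f (take t (x ∷ xs))) ≤ sum (map f (take t xs))
    sum-take-∷≤sum-take zero _ _ = z≤n
    sum-take-∷≤sum-take (suc t) (fx≤fy ∷ sorted) (s≤s t≤) =
      +-mono-≤ fx≤fy (sum-take-∷≤sum-take t sorted t≤)

    sum-take≤sum-sublist : ∀ {xs ys} t → Linked (_≤_ on f) xs → ys ⊆ xs → t ≤ length ys
                         → sum (map f (take t xs)) ≤ sum (map f ys)
    sum-take≤sum-sublist zero _ _ _ = z≤n
    sum-take≤sum-sublist (suc t) _ [] ()
    sum-take≤sum-sublist t sorted (_ ∷ʳ ys⊆xs) t≤ =
      ≤-trans (sum-take-∷≤sum-take t sorted (≤-trans t≤ (length-mono-≤ ys⊆xs)))
              (sum-take≤sum-sublist t (Linked.tail sorted) ys⊆xs t≤)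
    sum-take≤sum-sublist {x ∷ _} (suc t) sorted (refl ∷ ys⊆xs) (s≤s t≤) =
      +-monoʳ-≤ (f x) (sum-take≤sum-sublist t (Linked.tail sorted) ys⊆xs t≤)

module _ {n} (G : Graph n) where

  adj-swap : ∀ {u v} → adj G u v ≡ true → adj G v u ≡ true
  adj-swap {u} {v} uv = trans (adj-sym G v u) uv

  walk-head : ∀ {T a b} → ReachIn G T a b → a ∈ T
  walk-head (here a∈T) = a∈T
  walk-head (step a∈T _ _) = a∈T

  leaving-edge : ∀ {T a b} {Q I : Pred (Fin n) ℓ} → Decidable Q
               → ReachIn G T a b → Q a → ¬ Q b → I a
               → (∀ {u w} → Q u → I u → adj G u w ≡ true → I w)
               → ∃₂ λ u w → adj G u w ≡ true × w ∈ T × Q u × ¬ Q w × I u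
  leaving-edge Q? (here _) qa ¬qb _ _ = contradiction qa ¬qb
  leaving-edge Q? (step {w = w} _ aw walk) qa ¬qb ia preserve with Q? w
  ... | yes qw = leaving-edge Q? walk qw ¬qb (preserve qa ia aw) preserve
  ... | no ¬qw = _ , w , aw , walk-head walk , qa , ¬qw , ia

  module _ {X : Subset n} where

    walk-stays-in-component : ∀ {C D a b} → IsComponentOfMinus G X D
                            → ReachIn G C a b → (∀ v → v ∈ C → v ∉ X) → a ∈ D → b ∈ D
    walk-stays-in-component _ (here _) _ a∈D = a∈D
    walk-stays-in-component D-comp@(_ , _ , _ , D-closed) (step {u} {w} _ uw walk) C∩X=∅ u∈D =
      walk-stays-in-component D-comp walk C∩X=∅ (D-closed u w u∈D (C∩X=∅ w (walk-head walk)) uw)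

    components-≡ : ∀ {C D v} → IsComponentOfMinus G X C → IsComponentOfMinus G X D
                 → v ∈ C → v ∈ D → C ≡ D
    components-≡ C-comp@(_ , C∩X=∅ , C-conn , _) D-comp@(_ , D∩X=∅ , D-conn , _) v∈C v∈D =
      ⊆-antisym (λ u∈C → walk-stays-in-component D-comp (C-conn _ _ v∈C u∈C) C∩X=∅ v∈D)
                (λ u∈D → walk-stays-in-component C-comp (D-conn _ _ v∈D u∈D) D∩X=∅ v∈C)

module Ordering {n} (G : Graph n) (α : Permutation′ n) where

  pos-injective : ∀ {u v} → pos G α u ≡ pos G α v → u ≡ v
  pos-injective {u} {v} eq = begin
    u                             ≡⟨ inverseˡ α ⟨
    α ⟨$⟩ˡ (α ⟨$⟩ʳ u)             ≡⟨ cong (α ⟨$⟩ˡ_) (Fin.toℕ-injective eq) ⟩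
    α ⟨$⟩ˡ (α ⟨$⟩ʳ v)             ≡⟨ inverseˡ α ⟩
    v                             ∎
    where open ≡-Reasoning

  minN≤pos : ∀ {v u} → inN G v u ≡ true → minN G α v ≤ pos G α u
  minN≤pos {v} {u} u∈N[v] = go (allFin n) (∈-allFin u)
    where
    go : ∀ ws → u ∈ₗ ws
       → foldr (λ w acc → if inN G v w then pos G α w ⊓ acc else acc) (pos G α v) ws ≤ pos G α u
    go (w ∷ ws) (here refl) rewrite u∈N[v] = m⊓n≤m _ _
    go (w ∷ ws) (there u∈ws) with inN G v w
    ... | true = ≤-trans (m⊓n≤n _ _) (go ws u∈ws)
    ... | false = go ws u∈ws

  Crosses : ℕ → Fin n → Set
  Crosses i v = minN G α v < i × i ≤ pos G α v

  crosses? : ∀ i v → Dec (Crosses i v)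
  crosses? i v = minN G α v <? i ×-dec i ≤? pos G α v

  crossings : ℕ → ℕ
  crossings i = ∑[ v < n ] 𝟙 (crosses? i v)

  crossingsIn : Subset n → ℕ → ℕ
  crossingsIn S i = ∑[ v < n ] 𝟙 (v ∈? S ×-dec crosses? i v)

  ∑crossings≤profile : ∑[ j < n ] crossings (toℕ j) ≤ profileOf G α
  ∑crossings≤profile = begin
    ∑[ j < n ] ∑[ v < n ] 𝟙 (crosses? (toℕ j) v)
      ≡⟨ ∑-comm {n} {n} (λ j v → 𝟙 (crosses? (toℕ j) v)) ⟩
    ∑[ v < n ] ∑[ j < n ] 𝟙 (crosses? (toℕ j) v)
      ≤⟨ ∑-mono-≤ (λ v → ∑-interval n (minN G α v) (pos G α v)) ⟩
    ∑[ v < n ] (pos G α v ∸ minN G α v)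
      ≡⟨ sum-map-allFin (λ v → pos G α v ∸ minN G α v) ⟨
    profileOf G α ∎
    where open ≤-Reasoning

  crossingsIn-0 : ∀ S → crossingsIn S 0 ≡ 0
  crossingsIn-0 S = ∑-𝟙-≡0 (λ v → v ∈? S ×-dec crosses? 0 v) (λ { _ (_ , () , _) })

  crossing⇒1≤crossingsIn : ∀ {S i w} → w ∈ S → Crosses i w → 1 ≤ crossingsIn S i
  crossing⇒1≤crossingsIn {S} {i} {w} w∈S w-crosses = begin
    1                                   ≡⟨ 𝟙-yes (w∈S , w-crosses) (w ∈? S ×-dec crosses? i w) ⟨
    𝟙 (w ∈? S ×-dec crosses? i w)       ≤⟨ term≤∑ (λ v → 𝟙 (v ∈? S ×-dec crosses? i v)) w ⟩
    crossingsIn S i                     ∎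
    where open ≤-Reasoning

  edge-crosses : ∀ {u w i} → adj G u w ≡ true → pos G α u < i → i ≤ pos G α w → Crosses i w
  edge-crosses {u} {w} uw u<i i≤w = ≤-<-trans (minN≤pos u∈N[w]) u<i , i≤w
    where
    u∈N[w] : inN G w u ≡ true
    u∈N[w] = trans (cong (_ ∨_) (adj-swap G uw)) (∨-zeroʳ _)

  walk-crosses : ∀ {T a b i} → ReachIn G T a b → pos G α a < i → i ≤ pos G α b
               → ∃ λ w → w ∈ T × Crosses i w
  walk-crosses {i = i} walk a<i i≤b
    with leaving-edge G {I = λ _ → ⊤} (λ v → pos G α v <? i) walk a<i (≤⇒≯ i≤b) tt (λ _ _ _ → tt)
  ... | _ , w , uw , w∈T , u<i , w≮i , _ = w , w∈T , edge-crosses uw u<i (≮⇒≥ w≮i)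

  IsFirstIn : Subset n → Fin n → Set
  IsFirstIn S u = u ∈ S × ∀ v → v ∈ S → pos G α u ≤ pos G α v

  isFirstIn? : ∀ S u → Dec (IsFirstIn S u)
  isFirstIn? S u = u ∈? S ×-dec Fin.all? (λ v → v ∈? S →-dec pos G α u ≤? pos G α v)

  -- Every vertex u of S but the first has an earlier vertex in S, so S, being connected,
  -- contains a vertex crossing the cut at pos u; α turns these cuts into all cuts.
  size≤1+∑crossingsIn : ∀ {S} → InducedConnected G S → ∣ S ∣ ≤ suc (∑[ j < n ] crossingsIn S (toℕ j))
  size≤1+∑crossingsIn {S} S-conn = begin
    ∣ S ∣
      ≡⟨ ∣p∣≡∑𝟙∈ S ⟩
    ∑[ u < n ] 𝟙 (u ∈? S)
      ≤⟨ ∑-mono-≤ first-or-crossed ⟩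
    ∑[ u < n ] (𝟙 (isFirstIn? S u) + crossingsIn S (pos G α u))
      ≡⟨ ∑-distrib-+ (𝟙 ∘ isFirstIn? S) _ ⟩
    ∑[ u < n ] 𝟙 (isFirstIn? S u) + ∑[ u < n ] crossingsIn S (pos G α u)
      ≤⟨ +-monoˡ-≤ _ (∑-𝟙-≤1 (isFirstIn? S) first-unique) ⟩
    suc (∑[ u < n ] crossingsIn S (pos G α u))
      ≡⟨ cong suc (∑-permute (crossingsIn S ∘ toℕ) α) ⟨
    suc (∑[ j < n ] crossingsIn S (toℕ j)) ∎
    where
    open ≤-Reasoning
    first-unique : ∀ {u v} → IsFirstIn S u → IsFirstIn S v → u ≡ v
    first-unique (u∈S , u-first) (v∈S , v-first) =
      pos-injective (≤-antisym (u-first _ v∈S) (v-first _ u∈S))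
    crossed-if-in : ∀ {u v} → v ∈ S → pos G α v < pos G α u
                  → (u∈S? : Dec (u ∈ S)) → 𝟙 u∈S? ≤ crossingsIn S (pos G α u)
    crossed-if-in _ _ (no _) = z≤n
    crossed-if-in v∈S v<u (yes u∈S) =
      let w , w∈S , w-crosses = walk-crosses (S-conn _ _ v∈S u∈S) v<u ≤-refl
      in crossing⇒1≤crossingsIn w∈S w-crosses
    first-or-crossed : ∀ u → 𝟙 (u ∈? S) ≤ 𝟙 (isFirstIn? S u) + crossingsIn S (pos G α u)
    first-or-crossed u with Fin.any? (λ v → v ∈? S ×-dec pos G α v <? pos G α u)
    ... | yes (v , v∈S , v<u) = ≤-trans (crossed-if-in v∈S v<u (u ∈? S)) (m≤n+m _ _)
    ... | no none-earlier = ≤-trans (𝟙-mono first (u ∈? S) (isFirstIn? S u)) (m≤m+n _ _)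
      where
      first : u ∈ S → IsFirstIn S u
      first u∈S = u∈S , λ v v∈S → ≮⇒≥ (λ v<u → none-earlier (v , v∈S , v<u))

  module _ {r} (C : Fin r → Subset n) (disjoint : ∀ {c d v} → v ∈ C c → v ∈ C d → c ≡ d) where

    1+∑crossingsIn≤crossings : ∀ {i w} → Crosses i w → (∀ c → w ∉ C c)
                             → suc (∑[ c < r ] crossingsIn (C c) i) ≤ crossings i
    1+∑crossingsIn≤crossings {i} {w} w-crosses w∉C = begin-strict
      ∑[ c < r ] ∑[ v < n ] 𝟙 (v ∈? C c ×-dec crosses? i v)
        ≡⟨ ∑-comm {r} {n} (λ c v → 𝟙 (v ∈? C c ×-dec crosses? i v)) ⟩
      ∑[ v < n ] ∑[ c < r ] 𝟙 (v ∈? C c ×-dec crosses? i v)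
        <⟨ ∑-mono-< (λ v → at-most-crossing v (crosses? i v)) w w-not-counted ⟩
      ∑[ v < n ] 𝟙 (crosses? i v) ∎
      where
      open ≤-Reasoning
      at-most-crossing : ∀ v → Dec (Crosses i v)
                       → ∑[ c < r ] 𝟙 (v ∈? C c ×-dec crosses? i v) ≤ 𝟙 (crosses? i v)
      at-most-crossing v (yes v-crosses) = begin
        ∑[ c < r ] 𝟙 (v ∈? C c ×-dec crosses? i v)
          ≤⟨ ∑-mono-≤ (λ c → 𝟙-mono proj₁ (v ∈? C c ×-dec crosses? i v) (v ∈? C c)) ⟩
        ∑[ c < r ] 𝟙 (v ∈? C c)
          ≤⟨ ∑-𝟙-≤1 (λ c → v ∈? C c) disjoint ⟩
        1
          ≡⟨ 𝟙-yes v-crosses (crosses? i v) ⟨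
        𝟙 (crosses? i v) ∎
      at-most-crossing v (no ¬v-crosses) = begin
        ∑[ c < r ] 𝟙 (v ∈? C c ×-dec crosses? i v)
          ≡⟨ ∑-𝟙-≡0 (λ c → v ∈? C c ×-dec crosses? i v) (λ _ → ¬v-crosses ∘ proj₂) ⟩
        0
          ≤⟨ z≤n ⟩
        𝟙 (crosses? i v) ∎
      w-not-counted : ∑[ c < r ] 𝟙 (w ∈? C c ×-dec crosses? i w) < 𝟙 (crosses? i w)
      w-not-counted rewrite ∑-𝟙-≡0 (λ c → w ∈? C c ×-dec crosses? i w) (λ c → w∉C c ∘ proj₁)
                          | 𝟙-yes w-crosses (crosses? i w) = s≤s z≤n

module _ {m} (G : Graph (suc m)) (α : Permutation′ (suc m)) where
  open Ordering G α

  m+∑[∣C∣∸1]≤profile : ∀ {r} (C : Fin r → Subset (suc m))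
    → (∀ {c d v} → v ∈ C c → v ∈ C d → c ≡ d)
    → (∀ c → InducedConnected G (C c))
    → (∀ (j : Fin m) → ∃ λ w → Crosses (suc (toℕ j)) w × ∀ c → w ∉ C c)
    → m + ∑[ c < r ] (∣ C c ∣ ∸ 1) ≤ profileOf G α
  m+∑[∣C∣∸1]≤profile {r} C disjoint C-conn outside-crosser = begin
    m + ∑[ c < r ] (∣ C c ∣ ∸ 1)
      ≤⟨ +-monoʳ-≤ m (∑-mono-≤ (λ c → ∸-monoˡ-≤ 1 (size≤1+∑crossingsIn (C-conn c)))) ⟩
    m + ∑[ c < r ] ∑[ j < suc m ] crossingsIn (C c) (toℕ j)
      ≡⟨ cong (m +_) (sum-cong-≗ (λ c → cong (_+ ∑[ j < m ] crossingsIn (C c) (suc (toℕ j)))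
                                             (crossingsIn-0 (C c)))) ⟩
    m + ∑[ c < r ] ∑[ j < m ] crossingsIn (C c) (suc (toℕ j))
      ≡⟨ cong₂ _+_ (sym (∑-const-1 m)) (∑-comm {r} {m} (λ c j → crossingsIn (C c) (suc (toℕ j)))) ⟩
    ∑[ j < m ] 1 + ∑[ j < m ] ∑[ c < r ] crossingsIn (C c) (suc (toℕ j))
      ≡⟨ ∑-distrib-+ {m} (λ _ → 1) (λ j → ∑[ c < r ] crossingsIn (C c) (suc (toℕ j))) ⟨
    ∑[ j < m ] suc (∑[ c < r ] crossingsIn (C c) (suc (toℕ j)))
      ≤⟨ ∑-mono-≤ (λ j → let _ , w-crosses , w-outside = outside-crosser j
                          in 1+∑crossingsIn≤crossings C disjoint w-crosses w-outside) ⟩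
    ∑[ j < m ] crossings (suc (toℕ j))
      ≤⟨ m≤n+m _ _ ⟩
    ∑[ j < suc m ] crossings (toℕ j)
      ≤⟨ ∑crossings≤profile ⟩
    profileOf G α ∎
    where open ≤-Reasoning

  first last : Fin (suc m)
  first = α ⟨$⟩ˡ zero
  last = α ⟨$⟩ˡ fromℕ m

  pos-first : pos G α first ≡ 0
  pos-first = cong toℕ (inverseʳ α)

  pos-last : pos G α last ≡ m
  pos-last = trans (cong toℕ (inverseʳ α)) (Fin.toℕ-fromℕ m)

  module _ (X : Subset (suc m)) where

    IsInnerComponent : Subset (suc m) → Set
    IsInnerComponent C = IsComponentOfMinus G X C × first ∉ C × last ∉ C

    OutsideInner : Fin (suc m) → Set
    OutsideInner w = ∀ C → IsInnerComponent C → w ∉ C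

    outsideInner-step : ∀ {u w} → OutsideInner u → u ∉ X → adj G u w ≡ true → OutsideInner w
    outsideInner-step u-out u∉X uw C C-inner@((_ , _ , _ , C-closed) , _) w∈C =
      u-out C C-inner (C-closed _ _ w∈C u∉X (adj-swap G uw))

    outsideInner-first : OutsideInner first
    outsideInner-first _ (_ , first∉C , _) = first∉C

    outsideInner-last : OutsideInner last
    outsideInner-last _ (_ , _ , last∉C) = last∉C

    outsideInner-X : ∀ {w} → w ∈ X → OutsideInner w
    outsideInner-X w∈X _ ((_ , C∩X=∅ , _) , _) w∈C = C∩X=∅ _ w∈C w∈X

    outside-crosser : Connected G → InducedConnected G X → ∀ {i} → 0 < i → i ≤ m
                    → ∃ λ w → Crosses i w × OutsideInner w
    outside-crosser G-conn X-conn {i} 0<i i≤m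
      with Fin.any? (λ x → x ∈? X ×-dec pos G α x <? i) | Fin.any? (λ y → y ∈? X ×-dec i ≤? pos G α y)
    ... | yes (x , x∈X , x<i) | yes (y , y∈X , i≤y) =
      let w , w∈X , w-crosses = walk-crosses (X-conn x y x∈X y∈X) x<i i≤y
      in w , w-crosses , outsideInner-X w∈X
    ... | no none-below | _ = from-first
      where
      below-outside : ∀ {u} → pos G α u < i → u ∉ X
      below-outside u<i u∈X = none-below (_ , u∈X , u<i)
      from-first : ∃ λ w → Crosses i w × OutsideInner w
      from-first
        with leaving-edge G (λ v → pos G α v <? i) (G-conn first last)
               (subst (_< i) (sym pos-first) 0<i) (≤⇒≯ (subst (i ≤_) (sym pos-last) i≤m))
               outsideInner-first (λ u<i u-out → outsideInner-step u-out (below-outside u<i))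
      ... | u , w , uw , _ , u<i , w≮i , u-out =
        w , edge-crosses uw u<i (≮⇒≥ w≮i) , outsideInner-step u-out (below-outside u<i) uw
    ... | yes _ | no none-above = from-last
      where
      above-outside : ∀ {u} → i ≤ pos G α u → u ∉ X
      above-outside i≤u u∈X = none-above (_ , u∈X , i≤u)
      from-last : ∃ λ w → Crosses i w × OutsideInner w
      from-last
        with leaving-edge G (λ v → i ≤? pos G α v) (G-conn last first)
               (subst (i ≤_) (sym pos-last) i≤m) (<⇒≱ (subst (_< i) (sym pos-first) 0<i))
               outsideInner-last (λ i≤u u-out → outsideInner-step u-out (above-outside i≤u))
      ... | u , w , uw , _ , i≤u , w≱i , u-out =
        u , edge-crosses (adj-swap G uw) (≰⇒> w≱i) i≤u , u-out

    module InnerComponents {cs : List (Subset (suc m))} (cs-ok : NontrivialComponentsList G X cs) where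

      private
        cs-components : ∀ {C} → C ∈ₗ cs → IsNontrivialComponentOfMinus G X C
        cs-components = proj₁ cs-ok _
        cs-unique : Unique cs
        cs-unique = proj₁ (proj₂ (proj₂ cs-ok))
        cs-sorted : Linked (_≤_ on ∣_∣) cs
        cs-sorted = proj₂ (proj₂ (proj₂ cs-ok))

      avoiding-first : List (Subset (suc m))
      avoiding-first = filter (∁? (first ∈?_)) cs

      inner : List (Subset (suc m))
      inner = filter (∁? (last ∈?_)) avoiding-first

      inner⊆cs : inner ⊆ cs
      inner⊆cs = ⊆-trans (filter-⊆ (∁? (last ∈?_)) avoiding-first) (filter-⊆ (∁? (first ∈?_)) cs)

      inner-unique : Unique inner
      inner-unique = Unique.filter⁺ (∁? (last ∈?_)) (Unique.filter⁺ (∁? (first ∈?_)) cs-unique)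

      ∈-inner⁻ : ∀ {C} → C ∈ₗ inner → IsNontrivialComponentOfMinus G X C × IsInnerComponent C
      ∈-inner⁻ C∈inner with ∈-filter⁻ (∁? (last ∈?_)) C∈inner
      ... | C∈avoiding , last∉C with ∈-filter⁻ (∁? (first ∈?_)) C∈avoiding
      ...   | C∈cs , first∉C = cs-components C∈cs , proj₁ (cs-components C∈cs) , first∉C , last∉C

      length-cs≤2+length-inner : length cs ≤ 2 + length inner
      length-cs≤2+length-inner =
        ≤-trans (length≤1+length-filter-∁ (first ∈?_) cs-unique share)
                (s≤s (length≤1+length-filter-∁ (last ∈?_) (Unique.filter⁺ (∁? (first ∈?_)) cs-unique)
                                                (λ C∈ D∈ → share (in-cs C∈) (in-cs D∈))))
        where
        share : ∀ {C D v} → C ∈ₗ cs → D ∈ₗ cs → v ∈ C → v ∈ D → C ≡ D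
        share C∈cs D∈cs = components-≡ G (proj₁ (cs-components C∈cs)) (proj₁ (cs-components D∈cs))
        in-cs : ∀ {C} → C ∈ₗ avoiding-first → C ∈ₗ cs
        in-cs = proj₁ ∘ ∈-filter⁻ (∁? (first ∈?_))

      excess : ℕ
      excess = ∑[ c < length inner ] (∣ lookup inner c ∣ ∸ 1)

      m+excess≤profile : Connected G → InducedConnected G X → m + excess ≤ profileOf G α
      m+excess≤profile G-conn X-conn =
        m+∑[∣C∣∸1]≤profile (lookup inner) disjoint (λ c → proj₁ (proj₂ (proj₂ (component c))))
                            crosser-outside
        where
        component : ∀ c → IsComponentOfMinus G X (lookup inner c)
        component c = proj₁ (proj₁ (∈-inner⁻ (∈-lookup c)))
        disjoint : ∀ {c d v} → v ∈ lookup inner c → v ∈ lookup inner d → c ≡ d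
        disjoint {c} {d} v∈c v∈d =
          lookup-injective inner-unique (components-≡ G (component c) (component d) v∈c v∈d)
        crosser-outside : ∀ j → ∃ λ w → Crosses (suc (toℕ j)) w × ∀ c → w ∉ lookup inner c
        crosser-outside j =
          let w , w-crosses , w-out = outside-crosser G-conn X-conn (s≤s z≤n) (Fin.toℕ<n j)
          in w , w-crosses , λ c → w-out _ (proj₂ (∈-inner⁻ (∈-lookup c)))

      length-inner≤excess : length inner ≤ excess
      length-inner≤excess = subst (_≤ excess) (∑-const-1 (length inner))
        (∑-mono-≤ (λ c → ∸-monoˡ-≤ 1 (proj₂ (proj₁ (∈-inner⁻ (∈-lookup c))))))

      sum-size-inner≤excess+excess : sum (map ∣_∣ inner) ≤ excess + excess
      sum-size-inner≤excess+excess = begin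
        sum (map ∣_∣ inner)
          ≡⟨ sum-map-lookup ∣_∣ inner ⟩
        ∑[ c < length inner ] ∣ lookup inner c ∣
          ≤⟨ ∑-mono-≤ (λ c → ≤-pred+pred (proj₂ (proj₁ (∈-inner⁻ (∈-lookup c))))) ⟩
        ∑[ c < length inner ] ((∣ lookup inner c ∣ ∸ 1) + (∣ lookup inner c ∣ ∸ 1))
          ≡⟨ ∑-distrib-+ {length inner} (λ c → ∣ lookup inner c ∣ ∸ 1) _ ⟩
        excess + excess ∎
        where
        open ≤-Reasoning
        ≤-pred+pred : ∀ {x} → 2 ≤ x → x ≤ (x ∸ 1) + (x ∸ 1)
        ≤-pred+pred {suc (suc x)} _ = s≤s (m≤n+m (suc x) x)
        ≤-pred+pred {suc zero} (s≤s ())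

      length-cs≤excess+2 : length cs ≤ excess + 2
      length-cs≤excess+2 = begin
        length cs        ≤⟨ length-cs≤2+length-inner ⟩
        2 + length inner ≤⟨ +-monoʳ-≤ 2 length-inner≤excess ⟩
        2 + excess       ≡⟨ +-comm 2 excess ⟩
        excess + 2       ∎
        where open ≤-Reasoning

      sum-take≤2*excess : sum (map ∣_∣ (take (length cs ∸ 2) cs)) ≤ 2 * excess
      sum-take≤2*excess = begin
        sum (map ∣_∣ (take (length cs ∸ 2) cs))
          ≤⟨ sum-take≤sum-sublist ∣_∣ (length cs ∸ 2) cs-sorted inner⊆cs
               (m≤n+o⇒m∸n≤o (length cs) 2 length-cs≤2+length-inner) ⟩
        sum (map ∣_∣ inner)
          ≤⟨ sum-size-inner≤excess+excess ⟩
        excess + excess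
          ≡⟨ cong (excess +_) (+-identityʳ excess) ⟨
        2 * excess ∎
        where open ≤-Reasoning

lemma2p8 : (k : ℕ) → .{{_ : NonZero k}} → (n : ℕ) → (G : Graph n) → Connected G
    → (X : Subset n) → InducedConnected G X
    → (cs : List (Subset n)) → NontrivialComponentsList G X cs
    → (p : ℕ) → IsProfile G p → p ≤ k + n ∸ 1
    → length cs ≤ k + 2 × sum (map ∣_∣ (take (length cs ∸ 2) cs)) ≤ 2 * k
lemma2p8 k zero G _ X _ [] _ _ _ _ = z≤n , z≤n
lemma2p8 k zero G _ X _ (C ∷ _) cs-ok _ _ _ with proj₁ (proj₁ (proj₁ (proj₁ cs-ok C (here refl))))
... | ()
lemma2p8 k (suc m) G G-conn X X-conn cs cs-ok p ((α , profile≡p) , _) p≤k+m =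
  ≤-trans length-cs≤excess+2 (+-monoˡ-≤ 2 excess≤k) , ≤-trans sum-take≤2*excess (*-monoʳ-≤ 2 excess≤k)
  where
  open InnerComponents G α X cs-ok
  excess≤k : excess ≤ k
  excess≤k = +-cancelˡ-≤ m _ _ (begin
    m + excess    ≤⟨ m+excess≤profile G-conn X-conn ⟩
    profileOf G α ≡⟨ profile≡p ⟩
    p             ≤⟨ p≤k+m ⟩
    k + suc m ∸ 1 ≡⟨ cong (_∸ 1) (+-suc k m) ⟩
    k + m         ≡⟨ +-comm k m ⟩
    m + k         ∎)
    where open ≤-Reasoning
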